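{- Let $L=\langle a_1,a_2,\dots,a_k\rangle$ be a diagonal $\mathcal T(a_1)$-universal $\mathbb Z$-lattice with $2\le a_1\le a_2\le\dots\le a_k$. Let $r<s$ be positive integers with $r\le a_1-1$ and $s\le k-1$. Suppose there are integers $a_s<m_1<m_2<\dots<m_r<a_s+a_1$ and $1\le l_1<l_2<\dots<l_{s-r}\le s$ such that (1) for each $i=1,\dots,r$, $m_i$ is not represented by $\langle a_1,\dots,a_s\rangle$; (2) $\langle a_{l_1},a_{l_2},\dots,a_{l_{s-r}},m_1,m_2,\dots,m_r\rangle$ is $\mathcal T(a_1)$-universal. Then $L$ is not new.
   Context: For positive integers $a_1,\dots,a_k$, $\langle a_1,\dots,a_k\rangle$ is $\mathbb Z^k$ with $Q(x)=\sum a_ix_i^2$. An integer $m$ is represented by a lattice if $m=Q(\bm x)$ for some $\bm x$ in it. For a positive integer $n$, $\mathcal T(n)$ is the set of integers $\ge n$; a lattice is $\mathcal T(n)$-universal if it represents every element of $\mathcal T(n)$, and tight $\mathcal T(n)$-universal if the set of nonzero integers it represents is exactly $\mathcal T(n)$ (a $\mathcal T(a_1)$-universal lattice $\langle a_1,\dots,a_k\rangle$ with $a_1\le\dots\le a_k$ is automatically tight $\mathcal T(a_1)$-universal). A diagonal tight $\mathcal T(n)$-universal lattice $\langle a_1,\dots,a_k\rangle$ with $a_1\le\dots\le a_k$ is called new if for every proper subsequence $(a_{j_1},\dots,a_{j_l})$ of $(a_1,\dots,a_k)$, the lattice $\langle a_{j_1},\dots,a_{j_l}\rangle$ is not $\mathcal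 T(n)$-universal; here $n=a_1$. -}

module Defs where

open import Data.Nat using (ℕ; zero; suc)
import Data.Nat as ℕ
open import Data.Fin using (Fin; zero; suc)
import Data.Fin as Fin
open import Data.Integer using (ℤ; +_; _+_; _*_; _≤_; 0ℤ)
open import Data.Product using (∃; _×_)
open import Relation.Binary.PropositionalEquality using (_≡_; _≢_)
open import Relation.Nullary using (¬_)
open import Function using (_∘_)

-- A diagonal lattice ⟨a₁,…,a_k⟩ is given by its coefficient vector a : Fin k → ℕ
-- (a zero = a₁).  Its quadratic form on ℤ^k:  Q(x) = Σ a_i x_i².
Q : ∀ {k} → (Fin k → ℕ) → (Fin k → ℤ) → ℤ
Q {zero}  a x = 0ℤ
Q {suc k} a x = (+ a zero) * (x zero * x zero) + Q (a ∘ suc) (x ∘ suc)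

Represents : ∀ {k} → (Fin k → ℕ) → ℤ → Set
Represents a m = ∃ λ (x : Fin _ → ℤ) → Q a x ≡ m

TUniversal : ℕ → ∀ {k} → (Fin k → ℕ) → Set
TUniversal n a = (m : ℤ) → + n ≤ m → Represents a m

TightTUniversal : ℕ → ∀ {k} → (Fin k → ℕ) → Set
TightTUniversal n a = TUniversal n a × ((m : ℤ) → m ≢ 0ℤ → Represents a m → + n ≤ m)

StrictlyIncreasing : ∀ {l k} → (Fin l → Fin k) → Set
StrictlyIncreasing f = ∀ i j → i Fin.< j → f i Fin.< f j

Sorted : ∀ {k} → (Fin k → ℕ) → Set
Sorted a = ∀ i j → i Fin.≤ j → a i ℕ.≤ a j

IsNew : ∀ {k} → (Fin (suc k) → ℕ) → Set
IsNew {k} a =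
  TightTUniversal (a zero) a ×
  (∀ (l : ℕ) (f : Fin l → Fin (suc k)) → StrictlyIncreasing f → l ℕ.< suc k →
     ¬ TUniversal (a zero) (a ∘ f))

-- Each m_i is represented by L but not by ⟨a_1,…,a_s⟩, so some representation
-- of m_i has a nonzero coordinate j > s.  Since a_j ≥ a_s and every nonzero value
-- of the remaining terms is at least a_1, the bound m_i < a_s + a_1 forces
-- m_i = a_j.  These indices j increase with m_i, so together with l_1,…,l_{s-r}
-- they select a proper subsequence of the coefficients of L equal to those of
-- the given T(a_1)-universal lattice.
module Submission where

open import Defs
open import Data.Nat using (ℕ; zero; suc; _∸_; z≤n; s≤s)
import Data.Nat as ℕ
open import Data.Nat.Properties using (m<n⇒m<1+n; m≤n⇒m≤1+n)
import Data.Nat.Properties as NP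
open import Algebra.Properties.CommutativeSemigroup NP.+-commutativeSemigroup
  using (x∙yz≈y∙xz)
open import Data.Fin using (Fin; zero; suc; fromℕ<; inject≤; toℕ; splitAt; join)
import Data.Fin as Fin
import Data.Fin.Properties as FP
open import Data.Vec.Functional using (Vector; _++_; updateAt)
open import Data.Vec.Functional.Properties using (++-cong)
open import Data.Integer using (+_; -[1+_]; ∣_∣; +≤+; 0ℤ)
import Data.Integer as ℤ
import Data.Integer.Properties as ℤP
open import Data.Sum using (_⊎_; inj₁; inj₂; [_,_])
open import Data.Product using (∃; _,_; proj₁; proj₂; _×_)
open import Relation.Nullary using (¬_; contradiction)
open import Relation.Nullary.Decidable using (yes; no; _→-dec_; decidable-stable)
open import Relation.Binary.PropositionalEquality hiding ([_])
open import Function using (_∘_; const)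

Qℕ : ∀ {K} → (Fin K → ℕ) → (Fin K → ℕ) → ℕ
Qℕ {zero}  a y = 0
Qℕ {suc K} a y = a zero ℕ.* (y zero ℕ.* y zero) ℕ.+ Qℕ (a ∘ suc) (y ∘ suc)

i*i≡+∣i∣*∣i∣ : ∀ i → i ℤ.* i ≡ + (∣ i ∣ ℕ.* ∣ i ∣)
i*i≡+∣i∣*∣i∣ (+ n)    = sym (ℤP.pos-* n n)
i*i≡+∣i∣*∣i∣ -[1+ n ] = refl

Q≡+Qℕ∣∣ : ∀ {K} (a : Fin K → ℕ) x → Q a x ≡ + Qℕ a (∣_∣ ∘ x)
Q≡+Qℕ∣∣ {zero}  a x = refl
Q≡+Qℕ∣∣ {suc K} a x = begin
  + a zero ℤ.* (x zero ℤ.* x zero) ℤ.+ Q (a ∘ suc) (x ∘ suc)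
    ≡⟨ cong₂ (λ u v → + a zero ℤ.* u ℤ.+ v) (i*i≡+∣i∣*∣i∣ (x zero)) (Q≡+Qℕ∣∣ (a ∘ suc) (x ∘ suc)) ⟩
  + a zero ℤ.* + (y₀ ℕ.* y₀) ℤ.+ + q
    ≡⟨ cong (ℤ._+ + q) (sym (ℤP.pos-* (a zero) (y₀ ℕ.* y₀))) ⟩
  + (a zero ℕ.* (y₀ ℕ.* y₀)) ℤ.+ + q
    ≡⟨ sym (ℤP.pos-+ (a zero ℕ.* (y₀ ℕ.* y₀)) q) ⟩
  + Qℕ a (∣_∣ ∘ x) ∎
  where
  open ≡-Reasoning
  y₀ = ∣ x zero ∣
  q = Qℕ (a ∘ suc) (∣_∣ ∘ x ∘ suc)

Q-cong : ∀ {K} {a b : Fin K → ℕ} → a ≗ b → ∀ x → Q a x ≡ Q b x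
Q-cong {zero}  a≗b x = refl
Q-cong {suc K} a≗b x =
  cong₂ (λ u v → + u ℤ.* (x zero ℤ.* x zero) ℤ.+ v) (a≗b zero) (Q-cong (a≗b ∘ suc) (x ∘ suc))

TUniversal-cong : ∀ {n K} {a b : Fin K → ℕ} → a ≗ b → TUniversal n a → TUniversal n b
TUniversal-cong a≗b univ m n≤m with univ m n≤m
... | x , Qx≡m = x , trans (sym (Q-cong a≗b x)) Qx≡m

Q-vanishing : ∀ {K} (a : Fin K → ℕ) {x} → (∀ j → x j ≡ 0ℤ) → Q a x ≡ 0ℤ
Q-vanishing {zero}  a x≡0 = refl
Q-vanishing {suc K} a x≡0 = cong₂ ℤ._+_
  (trans (cong (λ u → + a zero ℤ.* (u ℤ.* u)) (x≡0 zero)) (ℤP.*-zeroʳ (+ a zero)))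
  (Q-vanishing (a ∘ suc) (x≡0 ∘ suc))

Q-restrict : ∀ {n K} (a : Fin K → ℕ) (p : n ℕ.≤ K) {x} → (∀ j → n ℕ.≤ toℕ j → x j ≡ 0ℤ) →
  Q a x ≡ Q (λ j → a (inject≤ j p)) (λ j → x (inject≤ j p))
Q-restrict {zero}          a p x≡0 = Q-vanishing a (λ j → x≡0 j z≤n)
Q-restrict {suc n} {suc K} a p {x} x≡0 =
  cong (ℤ._+_ (+ a zero ℤ.* (x zero ℤ.* x zero)))
    (Q-restrict (a ∘ suc) (ℕ.s≤s⁻¹ p) (λ j → x≡0 (suc j) ∘ s≤s))

Qℕ-updateAt-0 : ∀ {K} (a y : Fin K → ℕ) j →
  Qℕ a y ≡ a j ℕ.* (y j ℕ.* y j) ℕ.+ Qℕ a (updateAt y j (const 0))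
Qℕ-updateAt-0 a y zero rewrite NP.*-zeroʳ (a zero) = refl
Qℕ-updateAt-0 a y (suc j) = begin
  t₀ ℕ.+ Qℕ (a ∘ suc) (y ∘ suc) ≡⟨ cong (t₀ ℕ.+_) (Qℕ-updateAt-0 (a ∘ suc) (y ∘ suc) j) ⟩
  t₀ ℕ.+ (tⱼ ℕ.+ rest)           ≡⟨ x∙yz≈y∙xz t₀ tⱼ rest ⟩
  tⱼ ℕ.+ (t₀ ℕ.+ rest)           ∎
  where
  open ≡-Reasoning
  t₀ = a zero ℕ.* (y zero ℕ.* y zero)
  tⱼ = a (suc j) ℕ.* (y (suc j) ℕ.* y (suc j))
  rest = Qℕ (a ∘ suc) (updateAt (y ∘ suc) j (const 0))

Qℕ≡0⊎≥ : ∀ {K c} (a : Fin K → ℕ) → (∀ j → c ℕ.≤ a j) → ∀ y → Qℕ a y ≡ 0 ⊎ c ℕ.≤ Qℕ a y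
Qℕ≡0⊎≥ {zero}  a c≤a y = inj₁ refl
Qℕ≡0⊎≥ {suc K} a c≤a y with y zero
... | zero rewrite NP.*-zeroʳ (a zero) = Qℕ≡0⊎≥ (a ∘ suc) (c≤a ∘ suc) (y ∘ suc)
... | suc v = inj₂ (NP.≤-trans (c≤a zero)
                (NP.≤-trans (NP.m≤m*n (a zero) (suc v ℕ.* suc v)) (NP.m≤m+n _ _)))

single-term : ∀ {b c} y rest → c ℕ.≤ b → 1 ℕ.≤ y → rest ≡ 0 ⊎ c ℕ.≤ rest →
  b ℕ.* (y ℕ.* y) ℕ.+ rest ℕ.< b ℕ.+ c → b ℕ.* (y ℕ.* y) ℕ.+ rest ≡ b
single-term {b} (suc y) rest c≤b 1≤y (inj₂ c≤rest) <b+c =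
  contradiction (NP.+-mono-≤ (NP.m≤m*n b (suc y ℕ.* suc y)) c≤rest) (NP.<⇒≱ <b+c)
single-term {b} (suc zero) _ c≤b 1≤y (inj₁ refl) <b+c =
  trans (NP.+-identityʳ _) (NP.*-identityʳ b)
single-term {b} {c} (suc (suc y)) _ c≤b 1≤y (inj₁ refl) <b+c =
  contradiction b+c≤ (NP.<⇒≱ <b+c)
  where
  open NP.≤-Reasoning
  b+c≤ : b ℕ.+ c ℕ.≤ b ℕ.* (suc (suc y) ℕ.* suc (suc y)) ℕ.+ 0
  b+c≤ = begin
    b ℕ.+ c       ≤⟨ NP.+-monoʳ-≤ b c≤b ⟩
    b ℕ.+ b       ≡⟨ cong (b ℕ.+_) (sym (NP.+-identityʳ b)) ⟩
    2 ℕ.* b       ≤⟨ NP.*-monoˡ-≤ b (NP.m≤m+n 2 (y ℕ.+ suc y ℕ.* suc (suc y))) ⟩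
    (suc (suc y) ℕ.* suc (suc y)) ℕ.* b     ≡⟨ NP.*-comm (suc (suc y) ℕ.* suc (suc y)) b ⟩
    b ℕ.* (suc (suc y) ℕ.* suc (suc y))     ≡⟨ NP.+-identityʳ _ ⟨
    b ℕ.* (suc (suc y) ℕ.* suc (suc y)) ℕ.+ 0 ∎

value-is-coefficient : ∀ {K n c A M} (a : Fin K → ℕ) (p : n ℕ.≤ K) →
  (∀ j → c ℕ.≤ a j) → (∀ j → n ℕ.≤ toℕ j → A ℕ.≤ a j) → M ℕ.< A ℕ.+ c →
  Represents a (+ M) → ¬ Represents (λ j → a (inject≤ j p)) (+ M) →
  ∃ λ j → n ℕ.≤ toℕ j × a j ≡ M
value-is-coefficient {K} {n} {c} {_} {M} a p c≤a A≤a M<A+c (x , Qx≡M) unrep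
  with FP.all? (λ j → n NP.≤? toℕ j →-dec x j ℤ.≟ 0ℤ)
... | yes vanishes = contradiction (_ , trans (sym (Q-restrict a p vanishes)) Qx≡M) unrep
... | no ¬vanishes with FP.¬∀⟶∃¬ K _ (λ j → n NP.≤? toℕ j →-dec x j ℤ.≟ 0ℤ) ¬vanishes
... | j , ¬vⱼ =
  j , n≤j , sym (trans M≡ (single-term ∣ x j ∣ rest (c≤a j) 1≤y (Qℕ≡0⊎≥ a c≤a _) <aⱼ+c))
  where
  y = ∣_∣ ∘ x
  rest = Qℕ a (updateAt y j (const 0))
  n≤j : n ℕ.≤ toℕ j
  n≤j = decidable-stable (n NP.≤? toℕ j) (λ n≰j → ¬vⱼ (λ n≤j → contradiction n≤j n≰j))
  1≤y : 1 ℕ.≤ ∣ x j ∣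
  1≤y = NP.n≢0⇒n>0 (λ yⱼ≡0 → ¬vⱼ (λ _ → ℤP.∣i∣≡0⇒i≡0 yⱼ≡0))
  M≡ : M ≡ a j ℕ.* (y j ℕ.* y j) ℕ.+ rest
  M≡ = trans (ℤP.+-injective (trans (sym Qx≡M) (Q≡+Qℕ∣∣ a x))) (Qℕ-updateAt-0 a y j)
  <aⱼ+c : a j ℕ.* (y j ℕ.* y j) ℕ.+ rest ℕ.< a j ℕ.+ c
  <aⱼ+c = subst (ℕ._< a j ℕ.+ c) M≡ (NP.<-≤-trans M<A+c (NP.+-monoˡ-≤ c (A≤a j n≤j)))

sorted-reflects-strictlyIncreasing : ∀ {l K} {a : Fin K → ℕ} (f : Fin l → Fin K) → Sorted a →
  (∀ i j → i Fin.< j → a (f i) ℕ.< a (f j)) → StrictlyIncreasing f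
sorted-reflects-strictlyIncreasing f sorted a∘f-incr i j i<j =
  NP.≰⇒> (λ fj≤fi → NP.<⇒≱ (a∘f-incr i j i<j) (sorted (f j) (f i) fj≤fi))

++-strictlyIncreasing : ∀ {m n K} (g : Fin m → Fin K) (h : Fin n → Fin K) →
  StrictlyIncreasing g → StrictlyIncreasing h → (∀ u v → g u Fin.< h v) →
  StrictlyIncreasing (g ++ h)
++-strictlyIncreasing {m} {n} g h g-incr h-incr g<h i j i<j =
  on-sums (splitAt m i) (splitAt m j)
    (subst₂ Fin._<_ (sym (FP.join-splitAt m n i)) (sym (FP.join-splitAt m n j)) i<j)
  where
  on-sums : ∀ s s′ → join m n s Fin.< join m n s′ → [ g , h ] s Fin.< [ g , h ] s′
  on-sums (inj₁ u) (inj₁ u′) lt = g-incr u u′ (subst₂ ℕ._<_ (FP.toℕ-↑ˡ u n) (FP.toℕ-↑ˡ u′ n) lt)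
  on-sums (inj₁ u) (inj₂ v′) lt = g<h u v′
  on-sums (inj₂ v) (inj₁ u′) lt = contradiction
    (NP.≤-trans (NP.<⇒≤ (FP.toℕ<n u′)) (NP.m≤m+n m (toℕ v)))
    (NP.<⇒≱ (subst₂ ℕ._<_ (FP.toℕ-↑ʳ m v) (FP.toℕ-↑ˡ u′ n) lt))
  on-sums (inj₂ v) (inj₂ v′) lt =
    h-incr v v′ (NP.+-cancelˡ-< m _ _ (subst₂ ℕ._<_ (FP.toℕ-↑ʳ m v) (FP.toℕ-↑ʳ m v′) lt))

inject≤-strictlyIncreasing : ∀ {l n K} (f : Fin l → Fin n) (p : n ℕ.≤ K) →
  StrictlyIncreasing f → StrictlyIncreasing (λ u → inject≤ (f u) p)
inject≤-strictlyIncreasing f p f-incr u u′ u<u′ =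
  subst₂ ℕ._<_ (sym (FP.toℕ-inject≤ (f u) p)) (sym (FP.toℕ-inject≤ (f u′) p)) (f-incr u u′ u<u′)

∘-++ : ∀ {A B : Set} {m n} (F : A → B) (xs : Vector A m) (ys : Vector A n) →
  F ∘ (xs ++ ys) ≗ (F ∘ xs) ++ (F ∘ ys)
∘-++ {m = m} F xs ys i with splitAt m i
... | inj₁ _ = refl
... | inj₂ _ = refl

lemma2p2 : (k : ℕ) (a : Fin (suc k) → ℕ) →
    Sorted a → 2 ℕ.≤ a zero → TUniversal (a zero) a →
    (r t : ℕ) → 1 ℕ.≤ r → r ℕ.< suc t → r ℕ.≤ a zero ∸ 1 → (ht : suc t ℕ.≤ k) →
    (m : Fin r → ℕ) →
    (∀ i j → i Fin.< j → m i ℕ.< m j) →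
    (∀ i → a (fromℕ< (m<n⇒m<1+n ht)) ℕ.< m i) →
    (∀ i → m i ℕ.< a (fromℕ< (m<n⇒m<1+n ht)) ℕ.+ a zero) →
    (lidx : Fin (suc t ∸ r) → Fin (suc t)) → StrictlyIncreasing lidx →
    (∀ i → ¬ Represents (λ (j : Fin (suc t)) → a (inject≤ j (m≤n⇒m≤1+n ht))) (+ m i)) →
    TUniversal (a zero) ((λ i → a (inject≤ (lidx i) (m≤n⇒m≤1+n ht))) ++ m) →
    ¬ IsNew a
lemma2p2 k a sorted _ univ r t _ r<s _ ht m m-incr aₛ<m m<aₛ+a₁ lidx lidx-incr m-unrep univ′
  (_ , minimal) = minimal (suc t ∸ r ℕ.+ r) (old ++ new) old++new-incr shorter
    (TUniversal-cong a∘[old++new]≗ univ′)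
  where
  p = m≤n⇒m≤1+n ht
  s-1 = fromℕ< (m<n⇒m<1+n ht)
  found : ∀ i → ∃ λ j → suc t ℕ.≤ toℕ j × a j ≡ m i
  found i = value-is-coefficient a p (λ j → sorted zero j z≤n)
    (λ j s≤j → sorted s-1 j (NP.≤-trans (NP.≤-reflexive (FP.toℕ-fromℕ< _)) (NP.<⇒≤ s≤j)))
    (m<aₛ+a₁ i) (univ (+ m i) (+≤+ (NP.≤-trans (sorted zero s-1 z≤n) (NP.<⇒≤ (aₛ<m i)))))
    (m-unrep i)
  old : Fin (suc t ∸ r) → Fin (suc k)
  old u = inject≤ (lidx u) p
  new : Fin r → Fin (suc k)
  new = proj₁ ∘ found
  a∘new≗m : a ∘ new ≗ m
  a∘new≗m = proj₂ ∘ proj₂ ∘ found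
  old<s : ∀ u → toℕ (old u) ℕ.< suc t
  old<s u = subst (ℕ._< suc t) (sym (FP.toℕ-inject≤ (lidx u) p)) (FP.toℕ<n (lidx u))
  new-incr : StrictlyIncreasing new
  new-incr = sorted-reflects-strictlyIncreasing new sorted (λ i j i<j →
    subst₂ ℕ._<_ (sym (a∘new≗m i)) (sym (a∘new≗m j)) (m-incr i j i<j))
  old++new-incr : StrictlyIncreasing (old ++ new)
  old++new-incr = ++-strictlyIncreasing old new
    (inject≤-strictlyIncreasing lidx p lidx-incr) new-incr
    (λ u v → NP.<-≤-trans (old<s u) (proj₁ (proj₂ (found v))))
  shorter : suc t ∸ r ℕ.+ r ℕ.< suc k
  shorter = s≤s (subst (ℕ._≤ k) (sym (NP.m∸n+n≡m (NP.<⇒≤ r<s))) ht)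
  a∘[old++new]≗ : (a ∘ old) ++ m ≗ a ∘ (old ++ new)
  a∘[old++new]≗ i =
    sym (trans (∘-++ a old new i) (++-cong (a ∘ old) (a ∘ old) (λ _ → refl) a∘new≗m i))
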